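{- Let $n\ge1$ and let $S$ be a set of arrows on the node set $\{1,\ldots,n+1\}$. The set of $B$-diagonals whose arrow representations form $S$ is a face of Simion's type $B$ associahedron $\Gamma_n^B$ if and only if: (1) no two arrows of $S$ cross; (2) any two forward arrows of $S$ nest; (3) no backward arrow of $S$ nests a forward arrow of $S$; (4) no head of an arrow of $S$ is the tail of another arrow of $S$.
   Context: Label the vertices of a regular $(2n+2)$-gon clockwise by $1,\ldots,n+1,\overline{1},\ldots,\overline{n+1}$. A $B$-diagonal is either a diameter $\{i,\overline{i}\}$ ($1\le i\le n+1$), or $\{\{i,j\},\{\overline{i},\overline{j}\}\}$ with $1\le i<i+1<j\le n+1$, or $\{\{i,\overline{j}\},\{\overline{i},j\}\}$ with $1\le j<i\le n+1$. Two $B$-diagonals cross if a diagonal of one and a diagonal of the other meet in the interior of the polygon. $\Gamma_n^B$ is the simplicial complex on the $B$-diagonals whose faces are the pairwise noncrossing sets. An arrow $(i,j)$, $i\neq j$ in $\{1,\ldots,n+1\}$, has tail $i$ and head $j$; it is forward if $i<j$ and backward if $i>j$. The arrow representation is the bijection from $B$-diagonals to arrows: $\{i,\overline{i}\}\mapsto(i-1,i)$ for $2\le i\le n+1$, $\{1,\overline{1}\}\mapsto(n+1,1)$; $\{\{i,j\},\{\overline{i},\overline{j}\}\}\mapsto(j-1,i)$ for $1\le i<i+1<j\le n+1$; $\{\{i,\overline{j}\},\{\overline{i},j\}\}\mapsto(j-1,i)$ for $2\le j<i\le n+1$; $\{\{1,\overline{i}\},\{\overline{1},i\}\}\mapsto(n+1,i)$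 for $2\le i\le n+1$. The interval of an arrow $(x,y)$ is $\{\min(x,y),\ldots,\max(x,y)\}$. Two arrows cross if their intervals $[a_1,a_2]$, $[b_1,b_2]$ satisfy $a_1<b_1<a_2<b_2$ or $b_1<a_1<b_2<a_2$; an arrow nests another if its interval contains the other's interval; two arrows nest if one nests the other. -}

module Defs where

open import Data.Nat using (ℕ; zero; suc; _+_; _∸_; _≤_; _<_; _⊔_; _⊓_)
open import Data.Product using (_×_; _,_; proj₁; proj₂)
open import Data.Sum using (_⊎_)
open import Data.List using (List; []; _∷_)
open import Data.List.Relation.Unary.Any using (Any)
open import Relation.Binary.PropositionalEquality using (_≡_; _≢_)
open import Relation.Nullary using (¬_)

-- The regular (2n+2)-gon has vertices labelled
-- clockwise 1,…,n+1, 1̄,…,(n+1)̄.  We encode vertex k as position k and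
-- vertex k̄ as position (n+1)+k, so positions 1,…,2n+2 in clockwise order.

unbar : ℕ → ℕ → ℕ
unbar n k = k

bar : ℕ → ℕ → ℕ
bar n k = suc n + k

-- A chord (diagonal of the polygon) is an unordered pair of positions.
Chord : Set
Chord = ℕ × ℕ

-- Two chords (with distinct endpoints on a convex polygon) meet in the
-- interior iff their endpoints strictly interleave in cyclic order.
ChordCross : Chord → Chord → Set
ChordCross (a , b) (c , d) =
  let a₁ = a ⊓ b ; a₂ = a ⊔ b ; b₁ = c ⊓ d ; b₂ = c ⊔ d in
  (a₁ < b₁ × b₁ < a₂ × a₂ < b₂) ⊎ (b₁ < a₁ × a₁ < b₂ × b₂ < a₂)

-- B-diagonals (raw syntax, plus a validity predicate).
--   diam i      = {i, ī}
--   same i j    = {{i,j},{ī,j̄}}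
--   cross i j   = {{i,j̄},{ī,j}}

data BDiag : Set where
  diam  : ℕ → BDiag
  same  : ℕ → ℕ → BDiag
  cross : ℕ → ℕ → BDiag

IsBDiag : ℕ → BDiag → Set
IsBDiag n (diam i)    = 1 ≤ i × i ≤ suc n
IsBDiag n (same i j)  = 1 ≤ i × suc i < j × j ≤ suc n
IsBDiag n (cross i j) = 1 ≤ j × j < i × i ≤ suc n

chords : ℕ → BDiag → List Chord
chords n (diam i)    = (unbar n i , bar n i) ∷ []
chords n (same i j)  = (unbar n i , unbar n j) ∷ (bar n i , bar n j) ∷ []
chords n (cross i j) = (unbar n i , bar n j) ∷ (bar n i , unbar n j) ∷ []

BCross : ℕ → BDiag → BDiag → Set
BCross n d d' = Any (λ c → Any (λ c' → ChordCross c c') (chords n d')) (chords n d)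

IsFace : (n : ℕ) → (BDiag → Set) → Set
IsFace n F = (∀ d → F d → IsBDiag n d) ×
             (∀ d d' → F d → F d' → d ≢ d' → ¬ BCross n d d')

Arrow : Set
Arrow = ℕ × ℕ

tail head : Arrow → ℕ
tail = proj₁
head = proj₂

IsArrow : ℕ → Arrow → Set
IsArrow n (x , y) = 1 ≤ x × x ≤ suc n × 1 ≤ y × y ≤ suc n × x ≢ y

Forward Backward : Arrow → Set
Forward  (x , y) = x < y
Backward (x , y) = y < x

lo hi : Arrow → ℕ
lo (x , y) = x ⊓ y
hi (x , y) = x ⊔ y

ArrowCross : Arrow → Arrow → Set
ArrowCross a b =
  (lo a < lo b × lo b < hi a × hi a < hi b) ⊎
  (lo b < lo a × lo a < hi b × hi b < hi a)

Nests : Arrow → Arrow → Set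
Nests a b = lo a ≤ lo b × hi b ≤ hi a

arrowRep : ℕ → BDiag → Arrow
arrowRep n (diam (suc zero))    = (suc n , 1)
arrowRep n (diam i)             = (i ∸ 1 , i)
arrowRep n (same i j)           = (j ∸ 1 , i)
arrowRep n (cross i (suc zero)) = (suc n , i)
arrowRep n (cross i j)          = (j ∸ 1 , i)

diagsOf : ℕ → (Arrow → Set) → BDiag → Set
diagsOf n S d = IsBDiag n d × S (arrowRep n d)

Cond1 Cond2 Cond3 Cond4 : (Arrow → Set) → Set
Cond1 S = ∀ a b → S a → S b → a ≢ b → ¬ ArrowCross a b
Cond2 S = ∀ a b → S a → S b → a ≢ b → Forward a → Forward b → Nests a b ⊎ Nests b a
Cond3 S = ∀ a b → S a → S b → Backward a → Forward b → ¬ Nests a b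
Cond4 S = ∀ a b → S a → S b → a ≢ b → ¬ (head a ≡ tail b)

module Submission where

open import Defs
open import Data.Nat using (ℕ; zero; suc; _≤_; _<_; z≤n; s≤s; _≤?_; _≟_)
open import Data.Nat.Properties
open import Data.Product using (Σ; ∃-syntax; _×_; _,_; proj₁; proj₂)
open import Data.Product.Properties using (≡-dec)
open import Data.Sum using (_⊎_; inj₁; inj₂)
open import Data.Sum.Function.Propositional using (_⊎-⇔_)
open import Data.Empty using (⊥; ⊥-elim)
open import Data.List using (List; []; _∷_)
open import Data.List.Relation.Unary.Any using (Any; here; there)
import Data.List.Relation.Unary.Any as Any
open import Function using (_∘_)
open import Function.Bundles using (_⇔_; mk⇔; Equivalence)
open import Function.Construct.Identity using (⇔-id)
open import Function.Construct.Symmetry using (⇔-sym)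
open import Function.Construct.Composition using (_⇔-∘_)
open import Function.Related.Propositional using (module EquationalReasoning)
open import Relation.Binary.Definitions using (Symmetric; tri<; tri≈; tri>)
open import Relation.Binary.PropositionalEquality using (_≡_; _≢_; refl; sym; cong; subst; ≢-sym)
open import Relation.Nullary using (¬_; yes; no)
open import Relation.Nullary.Decidable using (_×-dec_)

-- Every arrow is the arrow of exactly one B-diagonal, and that diagonal's two chords can be
-- written down according to the kind of the arrow: forward, backward with tail at most n, or
-- backward with tail n+1.  Comparing endpoints kind by kind, the chords of two diagonals cross
-- exactly when their arrows violate one of the conditions (1)–(4), and no arrow violates them
-- together with itself; so the diagonals of S are pairwise noncrossing iff S satisfies (1)–(4).

-- Kinds of arrows and their B-diagonals

data Kind (n : ℕ) : Arrow → Set where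
  forward  : ∀ {x y} → 1 ≤ x → x < y → y ≤ suc n → Kind n (x , y)
  backward : ∀ {x y} → 1 ≤ y → y < x → x ≤ n → Kind n (x , y)
  wrapping : ∀ {y} → 1 ≤ y → y ≤ n → Kind n (suc n , y)

kind : ∀ {n a} → IsArrow n a → Kind n a
kind {n} {x , y} (1≤x , x≤1+n , 1≤y , y≤1+n , x≢y) with <-cmp x y
... | tri< x<y _ _ = forward 1≤x x<y y≤1+n
... | tri≈ _ x≡y _ = ⊥-elim (x≢y x≡y)
... | tri> _ _ y<x with x ≤? n
...   | yes x≤n = backward 1≤y y<x x≤n
...   | no x≰n with ≤-antisym x≤1+n (≰⇒> x≰n)
...     | refl = wrapping 1≤y (≤-pred y<x)

diagonalOf : ∀ {n a} → Kind n a → ∃[ d ] IsBDiag n d × arrowRep n d ≡ a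
diagonalOf (forward {suc x} {y} _ x<y y≤1+n) with m≤n⇒m<n∨m≡n x<y
... | inj₂ refl = diam (suc (suc x)) , (s≤s z≤n , y≤1+n) , refl
... | inj₁ 1+x<y = cross y (suc (suc x)) , (s≤s z≤n , 1+x<y , y≤1+n) , refl
diagonalOf (backward {x} {y} 1≤y y<x x≤n) = same y (suc x) , (1≤y , s≤s y<x , s≤s x≤n) , refl
diagonalOf (wrapping {suc zero} _ _) = diam 1 , (s≤s z≤n , s≤s z≤n) , refl
diagonalOf (wrapping {suc (suc y)} _ y≤n) =
  cross (suc (suc y)) 1 , (s≤s z≤n , s≤s (s≤s z≤n) , m≤n⇒m≤1+n y≤n) , refl

-- The two chords of the B-diagonal with arrow a, each with its smaller endpoint first.
chordPair : ∀ {n a} → Kind n a → Chord × Chord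
chordPair {n} (forward {x} {y} _ _ _)  = (y , bar n (suc x)) , (suc x , bar n y)
chordPair {n} (backward {x} {y} _ _ _) = (y , suc x) , (bar n y , bar n (suc x))
chordPair {n} (wrapping {y} _ _)       = (y , bar n 1) , (1 , bar n y)

Sorted : Chord → Set
Sorted (p , q) = p < q

unbar<bar : ∀ {n y k} → y ≤ suc n → 0 < k → y < bar n k
unbar<bar {n} y≤1+n 0<k = ≤-<-trans y≤1+n (m<m+n (suc n) 0<k)

bar≮unbar : ∀ {n k y} → bar n k < y → y ≤ suc n → ⊥
bar≮unbar {n} {k} bar<y y≤1+n = <⇒≱ bar<y (≤-trans y≤1+n (m≤m+n (suc n) k))

bar-cancel-< : ∀ {n a b} → bar n a < bar n b → a < b
bar-cancel-< {n} {a} {b} = +-cancelˡ-< (suc n) a b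

bar-mono-< : ∀ {n a b} → a < b → bar n a < bar n b
bar-mono-< {n} = +-monoʳ-< (suc n)

chordPair-sorted : ∀ {n a} (k : Kind n a) → Sorted (proj₁ (chordPair k)) × Sorted (proj₂ (chordPair k))
chordPair-sorted (forward 1≤x x<y y≤1+n) =
  unbar<bar y≤1+n (s≤s z≤n) , unbar<bar (≤-trans x<y y≤1+n) (≤-trans 1≤x (<⇒≤ x<y))
chordPair-sorted (backward _ y<x _) = m<n⇒m<1+n y<x , bar-mono-< (m<n⇒m<1+n y<x)
chordPair-sorted {n} (wrapping 1≤y y≤n) = s≤s (m≤n⇒m≤n+o 1 y≤n) , s≤s (≤-trans 1≤y (m≤n+m _ n))

OrientationInvariant : (Chord → Set) → Set
OrientationInvariant P = ∀ {p q} → P (p , q) → P (q , p)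

_Spans_ : List Chord → Chord × Chord → Set₁
cs Spans (c₁ , c₂) = ∀ P → OrientationInvariant P → Any P cs ⇔ (P c₁ ⊎ P c₂)

singleton-spans : ∀ {c} → (c ∷ []) Spans (c , c)
singleton-spans P _ = mk⇔ (λ { (here x) → inj₁ x }) (λ { (inj₁ x) → here x ; (inj₂ x) → here x })

pair-spans : ∀ {c₁ c₂} → (c₁ ∷ c₂ ∷ []) Spans (c₁ , c₂)
pair-spans P _ = mk⇔ (λ { (here x) → inj₁ x ; (there (here x)) → inj₂ x })
                     (λ { (inj₁ x) → here x ; (inj₂ x) → there (here x) })

pair-flipped-spans : ∀ {c p q} → (c ∷ (p , q) ∷ []) Spans (c , (q , p))
pair-flipped-spans P flip = mk⇔ (λ { (here x) → inj₁ x ; (there (here x)) → inj₂ (flip x) })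
                                (λ { (inj₁ x) → here x ; (inj₂ x) → there (here (flip x)) })

-- Validity of the arrow excludes the edge {n+1, 1̄}, which IsBDiag admits as cross (n+1) 1.
chords-spans : ∀ {n d} → IsBDiag n d → IsArrow n (arrowRep n d) →
               Σ (Kind n (arrowRep n d)) λ k → chords n d Spans chordPair k
chords-spans {d = diam (suc zero)} _ (_ , _ , _ , _ , 1+n≢1) =
  wrapping ≤-refl (n≢0⇒n>0 (1+n≢1 ∘ cong suc)) , singleton-spans
chords-spans {d = diam (suc (suc _))} (_ , i≤1+n) _ = forward (s≤s z≤n) ≤-refl i≤1+n , singleton-spans
chords-spans {d = same _ (suc _)} (1≤i , i<j , j≤1+n) _ =
  backward 1≤i (≤-pred i<j) (≤-pred j≤1+n) , pair-spans
chords-spans {d = cross _ (suc zero)} (_ , _ , i≤1+n) (_ , _ , 1≤i , _ , 1+n≢i) =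
  wrapping 1≤i (≤-pred (≤∧≢⇒< i≤1+n (≢-sym 1+n≢i))) , pair-flipped-spans
chords-spans {d = cross _ (suc (suc _))} (_ , j<i , i≤1+n) _ =
  forward (s≤s z≤n) (<-trans (n<1+n _) j<i) i≤1+n , pair-flipped-spans

-- ChordCross and ArrowCross are, definitionally, Interleave applied to sorted endpoints.
Interleave : ℕ → ℕ → ℕ → ℕ → Set
Interleave p q r s = (p < r × r < q × q < s) ⊎ (r < p × p < s × s < q)

interleave-sym : ∀ {p q r s} → Interleave p q r s → Interleave r s p q
interleave-sym (inj₁ i) = inj₂ i
interleave-sym (inj₂ i) = inj₁ i

Interleaved : Chord → Chord → Set
Interleaved (p , q) (r , s) = Interleave p q r s

interleaved-sym : Symmetric Interleaved
interleaved-sym {_ , _} {_ , _} = interleave-sym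

chordCross⇔interleaved : ∀ {c e} → Sorted c → Sorted e → ChordCross c e ⇔ Interleaved c e
chordCross⇔interleaved {p , q} {r , s} p<q r<s
  rewrite m≤n⇒m⊓n≡m (<⇒≤ p<q) | m≤n⇒m⊔n≡n (<⇒≤ p<q) | m≤n⇒m⊓n≡m (<⇒≤ r<s) | m≤n⇒m⊔n≡n (<⇒≤ r<s)
  = ⇔-id _

chordCross-flipˡ : ∀ {e} → OrientationInvariant (λ c → ChordCross c e)
chordCross-flipˡ {p = p} {q} cr rewrite ⊓-comm q p | ⊔-comm q p = cr

chordCross-flipʳ : ∀ {c} → OrientationInvariant (ChordCross c)
chordCross-flipʳ {p = p} {q} cr rewrite ⊓-comm q p | ⊔-comm q p = cr

data Meet (R : Chord → Chord → Set) (A B : Chord × Chord) : Set where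
  ₁₁ : R (proj₁ A) (proj₁ B) → Meet R A B
  ₁₂ : R (proj₁ A) (proj₂ B) → Meet R A B
  ₂₁ : R (proj₂ A) (proj₁ B) → Meet R A B
  ₂₂ : R (proj₂ A) (proj₂ B) → Meet R A B

meet⇔⊎ : ∀ {R c₁ c₂ e₁ e₂} → Meet R (c₁ , c₂) (e₁ , e₂) ⇔ ((R c₁ e₁ ⊎ R c₁ e₂) ⊎ (R c₂ e₁ ⊎ R c₂ e₂))
meet⇔⊎ = mk⇔ (λ { (₁₁ r) → inj₁ (inj₁ r) ; (₁₂ r) → inj₁ (inj₂ r) ; (₂₁ r) → inj₂ (inj₁ r) ; (₂₂ r) → inj₂ (inj₂ r) })
             (λ { (inj₁ (inj₁ r)) → ₁₁ r ; (inj₁ (inj₂ r)) → ₁₂ r ; (inj₂ (inj₁ r)) → ₂₁ r ; (inj₂ (inj₂ r)) → ₂₂ r })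

meet-sym : ∀ {R A B} → Symmetric R → Meet R A B → Meet R B A
meet-sym sym (₁₁ r) = ₁₁ (sym r)
meet-sym sym (₁₂ r) = ₂₁ (sym r)
meet-sym sym (₂₁ r) = ₁₂ (sym r)
meet-sym sym (₂₂ r) = ₂₂ (sym r)

meet-cong : ∀ {R R′ c₁ c₂ e₁ e₂} →
            R c₁ e₁ ⇔ R′ c₁ e₁ → R c₁ e₂ ⇔ R′ c₁ e₂ → R c₂ e₁ ⇔ R′ c₂ e₁ → R c₂ e₂ ⇔ R′ c₂ e₂ →
            Meet R (c₁ , c₂) (e₁ , e₂) ⇔ Meet R′ (c₁ , c₂) (e₁ , e₂)
meet-cong r₁₁ r₁₂ r₂₁ r₂₂ = ⇔-sym meet⇔⊎ ⇔-∘ (((r₁₁ ⊎-⇔ r₁₂) ⊎-⇔ (r₂₁ ⊎-⇔ r₂₂)) ⇔-∘ meet⇔⊎)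

meet-sorted : ∀ {c₁ c₂ e₁ e₂} → Sorted c₁ × Sorted c₂ → Sorted e₁ × Sorted e₂ →
              Meet ChordCross (c₁ , c₂) (e₁ , e₂) ⇔ Meet Interleaved (c₁ , c₂) (e₁ , e₂)
meet-sorted (s₁ , s₂) (t₁ , t₂) =
  meet-cong (chordCross⇔interleaved s₁ t₁) (chordCross⇔interleaved s₁ t₂)
            (chordCross⇔interleaved s₂ t₁) (chordCross⇔interleaved s₂ t₂)

bcross⇔meet : ∀ {n d d′ A B} → chords n d Spans A → chords n d′ Spans B → BCross n d d′ ⇔ Meet ChordCross A B
bcross⇔meet {n} {d} {d′} {c₁ , c₂} {e₁ , e₂} spans spans′ = begin
  BCross n d d′
    ∼⟨ spans (λ c → Any (ChordCross c) (chords n d′)) (Any.map chordCross-flipˡ) ⟩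
  (Any (ChordCross c₁) (chords n d′) ⊎ Any (ChordCross c₂) (chords n d′))
    ∼⟨ spans′ (ChordCross c₁) chordCross-flipʳ ⊎-⇔ spans′ (ChordCross c₂) chordCross-flipʳ ⟩
  ((ChordCross c₁ e₁ ⊎ ChordCross c₁ e₂) ⊎ (ChordCross c₂ e₁ ⊎ ChordCross c₂ e₂))
    ∼⟨ ⇔-sym meet⇔⊎ ⟩
  Meet ChordCross (c₁ , c₂) (e₁ , e₂) ∎
  where open EquationalReasoning

-- The endpoints of the two intervals are parameters, so that a case analysis can use their
-- known values instead of lo and hi.
data ConflictOn (a b : Arrow) (la ha lb hb : ℕ) : Set where
  crossing       : Interleave la ha lb hb → ConflictOn a b la ha lb hb
  unnested       : Forward a → Forward b → ¬ (la ≤ lb × hb ≤ ha) → ¬ (lb ≤ la × ha ≤ hb) →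
                   ConflictOn a b la ha lb hb
  backwardNestsˡ : Backward a → Forward b → la ≤ lb × hb ≤ ha → ConflictOn a b la ha lb hb
  backwardNestsʳ : Backward b → Forward a → lb ≤ la × ha ≤ hb → ConflictOn a b la ha lb hb
  linkedˡ        : head a ≡ tail b → ConflictOn a b la ha lb hb
  linkedʳ        : head b ≡ tail a → ConflictOn a b la ha lb hb

Conflict : Arrow → Arrow → Set
Conflict a b = ConflictOn a b (lo a) (hi a) (lo b) (hi b)

conflict-endpoints : ∀ {a b la ha lb hb} → lo a ≡ la → hi a ≡ ha → lo b ≡ lb → hi b ≡ hb →
                     ConflictOn a b la ha lb hb ⇔ Conflict a b
conflict-endpoints refl refl refl refl = ⇔-id _

conflictOn-sym : ∀ {a b la ha lb hb} → ConflictOn a b la ha lb hb → ConflictOn b a lb hb la ha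
conflictOn-sym (crossing i)              = crossing (interleave-sym i)
conflictOn-sym (unnested fa fb ¬ab ¬ba)  = unnested fb fa ¬ba ¬ab
conflictOn-sym (backwardNestsˡ ba fb ab) = backwardNestsʳ ba fb ab
conflictOn-sym (backwardNestsʳ bb fa ba) = backwardNestsˡ bb fa ba
conflictOn-sym (linkedˡ e)               = linkedʳ e
conflictOn-sym (linkedʳ e)               = linkedˡ e

conflict-irreflexive : ∀ {a} → tail a ≢ head a → ¬ Conflict a a
conflict-irreflexive _ (crossing (inj₁ (l<l , _))) = <-irrefl refl l<l
conflict-irreflexive _ (crossing (inj₂ (l<l , _))) = <-irrefl refl l<l
conflict-irreflexive _ (unnested _ _ ¬aa _)       = ¬aa (≤-refl , ≤-refl)
conflict-irreflexive _ (backwardNestsˡ ba fa _)   = <-asym ba fa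
conflict-irreflexive _ (backwardNestsʳ ba fa _)   = <-asym ba fa
conflict-irreflexive t≢h (linkedˡ e)              = t≢h (sym e)
conflict-irreflexive t≢h (linkedʳ e)              = t≢h (sym e)

lo-forward : ∀ {x y} → x < y → lo (x , y) ≡ x
lo-forward x<y = m≤n⇒m⊓n≡m (<⇒≤ x<y)

hi-forward : ∀ {x y} → x < y → hi (x , y) ≡ y
hi-forward x<y = m≤n⇒m⊔n≡n (<⇒≤ x<y)

lo-backward : ∀ {x y} → y < x → lo (x , y) ≡ y
lo-backward y<x = m≥n⇒m⊓n≡n (<⇒≤ y<x)

hi-backward : ∀ {x y} → y < x → hi (x , y) ≡ x
hi-backward y<x = m≥n⇒m⊔n≡m (<⇒≤ y<x)

Staggered : ℕ → ℕ → ℕ → ℕ → Set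
Staggered x₁ y₁ x₂ y₂ = (x₁ < x₂ × y₁ < y₂) ⊎ (x₂ < x₁ × y₂ < y₁)

staggered⇔unnested : ∀ {x₁ y₁ x₂ y₂} →
                     Staggered x₁ y₁ x₂ y₂ ⇔ (¬ (x₁ ≤ x₂ × y₂ ≤ y₁) × ¬ (x₂ ≤ x₁ × y₁ ≤ y₂))
staggered⇔unnested {x₁} {y₁} {x₂} {y₂} = mk⇔ to from
  where
  to : Staggered x₁ y₁ x₂ y₂ → ¬ (x₁ ≤ x₂ × y₂ ≤ y₁) × ¬ (x₂ ≤ x₁ × y₁ ≤ y₂)
  to (inj₁ (x₁<x₂ , y₁<y₂)) = (λ (_ , y₂≤y₁) → <⇒≱ y₁<y₂ y₂≤y₁) , (λ (x₂≤x₁ , _) → <⇒≱ x₁<x₂ x₂≤x₁)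
  to (inj₂ (x₂<x₁ , y₂<y₁)) = (λ (x₁≤x₂ , _) → <⇒≱ x₂<x₁ x₁≤x₂) , (λ (_ , y₁≤y₂) → <⇒≱ y₂<y₁ y₁≤y₂)
  from : ¬ (x₁ ≤ x₂ × y₂ ≤ y₁) × ¬ (x₂ ≤ x₁ × y₁ ≤ y₂) → Staggered x₁ y₁ x₂ y₂
  from (¬12 , ¬21) with <-cmp x₁ x₂
  ... | tri< x₁<x₂ _ _ = inj₁ (x₁<x₂ , ≰⇒> λ y₂≤y₁ → ¬12 (<⇒≤ x₁<x₂ , y₂≤y₁))
  ... | tri> _ _ x₂<x₁ = inj₂ (x₂<x₁ , ≰⇒> λ y₁≤y₂ → ¬21 (<⇒≤ x₂<x₁ , y₁≤y₂))
  ... | tri≈ _ refl _ with ≤-total y₁ y₂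
  ...   | inj₁ y₁≤y₂ = ⊥-elim (¬21 (≤-refl , y₁≤y₂))
  ...   | inj₂ y₂≤y₁ = ⊥-elim (¬12 (≤-refl , y₂≤y₁))

-- Crossing diagonals versus conflicting arrows, kind by kind

module ForwardForward {n x₁ y₁ x₂ y₂ : ℕ}
  (1≤x₁ : 1 ≤ x₁) (x₁<y₁ : x₁ < y₁) (y₁≤1+n : y₁ ≤ suc n)
  (1≤x₂ : 1 ≤ x₂) (x₂<y₂ : x₂ < y₂) (y₂≤1+n : y₂ ≤ suc n) where

  ChordsMeet : Set
  ChordsMeet = Meet Interleaved (chordPair (forward 1≤x₁ x₁<y₁ y₁≤1+n)) (chordPair (forward 1≤x₂ x₂<y₂ y₂≤1+n))

  Order : Set
  Order = Staggered x₁ y₁ x₂ y₂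

  left-of : y₁ ≤ x₂ → Order
  left-of y₁≤x₂ = inj₁ (<-≤-trans x₁<y₁ y₁≤x₂ , ≤-<-trans y₁≤x₂ x₂<y₂)

  right-of : y₂ ≤ x₁ → Order
  right-of y₂≤x₁ = inj₂ (<-≤-trans x₂<y₂ y₂≤x₁ , ≤-<-trans y₂≤x₁ x₁<y₁)

  meet→order : ChordsMeet → Order
  meet→order (₁₁ (inj₁ (a , _ , c))) = inj₁ (≤-pred (bar-cancel-< c) , a)
  meet→order (₁₁ (inj₂ (a , _ , c))) = inj₂ (≤-pred (bar-cancel-< c) , a)
  meet→order (₁₂ (inj₁ (a , _ , _))) = left-of (≤-pred a)
  meet→order (₁₂ (inj₂ (_ , _ , c))) = right-of (≤-pred (bar-cancel-< c))
  meet→order (₂₁ (inj₁ (_ , _ , c))) = left-of (≤-pred (bar-cancel-< c))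
  meet→order (₂₁ (inj₂ (a , _ , _))) = right-of (≤-pred a)
  meet→order (₂₂ (inj₁ (a , _ , c))) = inj₁ (≤-pred a , bar-cancel-< c)
  meet→order (₂₂ (inj₂ (a , _ , c))) = inj₂ (≤-pred a , bar-cancel-< c)

  order→meet : Order → ChordsMeet
  order→meet (inj₁ (x₁<x₂ , y₁<y₂)) =
    ₂₂ (inj₁ (s≤s x₁<x₂ , unbar<bar (≤-trans x₂<y₂ y₂≤1+n) (≤-trans 1≤x₁ (<⇒≤ x₁<y₁)) , bar-mono-< y₁<y₂))
  order→meet (inj₂ (x₂<x₁ , y₂<y₁)) =
    ₂₂ (inj₂ (s≤s x₂<x₁ , unbar<bar (≤-trans x₁<y₁ y₁≤1+n) (≤-trans 1≤x₂ (<⇒≤ x₂<y₂)) , bar-mono-< y₂<y₁))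

  conflict→order : ConflictOn (x₁ , y₁) (x₂ , y₂) x₁ y₁ x₂ y₂ → Order
  conflict→order (crossing (inj₁ (a , _ , c))) = inj₁ (a , c)
  conflict→order (crossing (inj₂ (a , _ , c))) = inj₂ (a , c)
  conflict→order (unnested _ _ ¬12 ¬21)         = Equivalence.from staggered⇔unnested (¬12 , ¬21)
  conflict→order (backwardNestsˡ y₁<x₁ _ _)     = ⊥-elim (<-asym x₁<y₁ y₁<x₁)
  conflict→order (backwardNestsʳ y₂<x₂ _ _)     = ⊥-elim (<-asym x₂<y₂ y₂<x₂)
  conflict→order (linkedˡ y₁≡x₂)                = left-of (≤-reflexive y₁≡x₂)
  conflict→order (linkedʳ y₂≡x₁)                = right-of (≤-reflexive y₂≡x₁)

  order→conflict : Order → ConflictOn (x₁ , y₁) (x₂ , y₂) x₁ y₁ x₂ y₂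
  order→conflict o = let ¬12 , ¬21 = Equivalence.to staggered⇔unnested o in unnested x₁<y₁ x₂<y₂ ¬12 ¬21

  meet⇔conflict : ChordsMeet ⇔ Conflict (x₁ , y₁) (x₂ , y₂)
  meet⇔conflict =
    conflict-endpoints (lo-forward x₁<y₁) (hi-forward x₁<y₁) (lo-forward x₂<y₂) (hi-forward x₂<y₂)
      ⇔-∘ mk⇔ (order→conflict ∘ meet→order) (order→meet ∘ conflict→order)

module ForwardBackward {n x₁ y₁ x₂ y₂ : ℕ}
  (1≤x₁ : 1 ≤ x₁) (x₁<y₁ : x₁ < y₁) (y₁≤1+n : y₁ ≤ suc n)
  (1≤y₂ : 1 ≤ y₂) (y₂<x₂ : y₂ < x₂) (x₂≤n : x₂ ≤ n) where

  ChordsMeet : Set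
  ChordsMeet = Meet Interleaved (chordPair (forward 1≤x₁ x₁<y₁ y₁≤1+n)) (chordPair (backward 1≤y₂ y₂<x₂ x₂≤n))

  Order : Set
  Order = (y₂ < y₁ × y₁ ≤ x₂) ⊎ (y₂ ≤ x₁ × x₁ < x₂)

  meet→order : ChordsMeet → Order
  meet→order (₁₁ (inj₁ (_ , _ , c))) = ⊥-elim (bar≮unbar c (s≤s x₂≤n))
  meet→order (₁₁ (inj₂ (a , b , _))) = inj₁ (a , ≤-pred b)
  meet→order (₁₂ (inj₁ (_ , b , c))) = inj₂ (≤-pred (bar-cancel-< b) , ≤-pred (bar-cancel-< c))
  meet→order (₁₂ (inj₂ (a , _ , _))) = ⊥-elim (bar≮unbar a y₁≤1+n)
  meet→order (₂₁ (inj₁ (_ , _ , c))) = ⊥-elim (bar≮unbar c (s≤s x₂≤n))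
  meet→order (₂₁ (inj₂ (a , b , _))) = inj₂ (≤-pred a , ≤-pred b)
  meet→order (₂₂ (inj₁ (_ , b , c))) = inj₁ (bar-cancel-< b , ≤-pred (bar-cancel-< c))
  meet→order (₂₂ (inj₂ (a , _ , _))) = ⊥-elim (bar≮unbar a (≤-trans x₁<y₁ y₁≤1+n))

  order→meet : Order → ChordsMeet
  order→meet (inj₁ (y₂<y₁ , y₁≤x₂)) =
    ₁₁ (inj₂ (y₂<y₁ , s≤s y₁≤x₂ , unbar<bar (s≤s x₂≤n) (s≤s z≤n)))
  order→meet (inj₂ (y₂≤x₁ , x₁<x₂)) =
    ₂₁ (inj₂ (s≤s y₂≤x₁ , s≤s x₁<x₂ , unbar<bar (s≤s x₂≤n) (≤-trans 1≤x₁ (<⇒≤ x₁<y₁))))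

  conflict→order : ConflictOn (x₁ , y₁) (x₂ , y₂) x₁ y₁ y₂ x₂ → Order
  conflict→order (crossing (inj₁ (_ , b , c)))  = inj₁ (b , <⇒≤ c)
  conflict→order (crossing (inj₂ (a , b , _)))  = inj₂ (<⇒≤ a , b)
  conflict→order (unnested _ x₂<y₂ _ _)          = ⊥-elim (<-asym y₂<x₂ x₂<y₂)
  conflict→order (backwardNestsˡ y₁<x₁ _ _)      = ⊥-elim (<-asym x₁<y₁ y₁<x₁)
  conflict→order (backwardNestsʳ _ _ (y₂≤x₁ , y₁≤x₂)) = inj₁ (≤-<-trans y₂≤x₁ x₁<y₁ , y₁≤x₂)
  conflict→order (linkedˡ y₁≡x₂) = inj₁ (subst (y₂ <_) (sym y₁≡x₂) y₂<x₂ , ≤-reflexive y₁≡x₂)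
  conflict→order (linkedʳ y₂≡x₁) = inj₂ (≤-reflexive y₂≡x₁ , subst (_< x₂) y₂≡x₁ y₂<x₂)

  order→conflict : Order → ConflictOn (x₁ , y₁) (x₂ , y₂) x₁ y₁ y₂ x₂
  order→conflict (inj₁ (y₂<y₁ , y₁≤x₂)) with m≤n⇒m<n∨m≡n y₁≤x₂
  ... | inj₂ y₁≡x₂ = linkedˡ y₁≡x₂
  ... | inj₁ y₁<x₂ with <-cmp y₂ x₁
  ...   | tri< y₂<x₁ _ _ = backwardNestsʳ y₂<x₂ x₁<y₁ (<⇒≤ y₂<x₁ , y₁≤x₂)
  ...   | tri≈ _ y₂≡x₁ _ = linkedʳ y₂≡x₁
  ...   | tri> _ _ x₁<y₂ = crossing (inj₁ (x₁<y₂ , y₂<y₁ , y₁<x₂))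
  order→conflict (inj₂ (y₂≤x₁ , x₁<x₂)) with m≤n⇒m<n∨m≡n y₂≤x₁
  ... | inj₂ y₂≡x₁ = linkedʳ y₂≡x₁
  ... | inj₁ y₂<x₁ with y₁ ≤? x₂
  ...   | yes y₁≤x₂ = backwardNestsʳ y₂<x₂ x₁<y₁ (y₂≤x₁ , y₁≤x₂)
  ...   | no y₁≰x₂ = crossing (inj₂ (y₂<x₁ , x₁<x₂ , ≰⇒> y₁≰x₂))

  meet⇔conflict : ChordsMeet ⇔ Conflict (x₁ , y₁) (x₂ , y₂)
  meet⇔conflict =
    conflict-endpoints (lo-forward x₁<y₁) (hi-forward x₁<y₁) (lo-backward y₂<x₂) (hi-backward y₂<x₂)
      ⇔-∘ mk⇔ (order→conflict ∘ meet→order) (order→meet ∘ conflict→order)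

module ForwardWrapping {n x₁ y₁ y₂ : ℕ}
  (1≤x₁ : 1 ≤ x₁) (x₁<y₁ : x₁ < y₁) (y₁≤1+n : y₁ ≤ suc n)
  (1≤y₂ : 1 ≤ y₂) (y₂≤n : y₂ ≤ n) where

  ChordsMeet : Set
  ChordsMeet = Meet Interleaved (chordPair (forward 1≤x₁ x₁<y₁ y₁≤1+n)) (chordPair (wrapping 1≤y₂ y₂≤n))

  Order : Set
  Order = y₂ < y₁ ⊎ y₂ ≤ x₁

  1≤y₁ : 1 ≤ y₁
  1≤y₁ = ≤-trans 1≤x₁ (<⇒≤ x₁<y₁)

  meet→order : ChordsMeet → Order
  meet→order (₁₁ (inj₁ (_ , _ , c))) = ⊥-elim (<⇒≱ (bar-cancel-< c) (s≤s z≤n))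
  meet→order (₁₁ (inj₂ (a , _ , _))) = inj₁ a
  meet→order (₁₂ (inj₁ (a , _ , _))) = ⊥-elim (<⇒≱ a 1≤y₁)
  meet→order (₁₂ (inj₂ (_ , _ , c))) = inj₂ (≤-pred (bar-cancel-< c))
  meet→order (₂₁ (inj₁ (_ , _ , c))) = ⊥-elim (<⇒≱ (bar-cancel-< c) 1≤y₁)
  meet→order (₂₁ (inj₂ (a , _ , _))) = inj₂ (≤-pred a)
  meet→order (₂₂ (inj₁ (a , _ , _))) = ⊥-elim (<⇒≱ a (s≤s z≤n))
  meet→order (₂₂ (inj₂ (_ , _ , c))) = inj₁ (bar-cancel-< c)

  order→meet : Order → ChordsMeet
  order→meet (inj₁ y₂<y₁) = ₁₁ (inj₂ (y₂<y₁ , unbar<bar y₁≤1+n (s≤s z≤n) , bar-mono-< (s≤s 1≤x₁)))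
  order→meet (inj₂ y₂≤x₁) =
    ₂₁ (inj₂ (s≤s y₂≤x₁ , unbar<bar (≤-trans x₁<y₁ y₁≤1+n) (s≤s z≤n) , bar-mono-< (≤-<-trans 1≤x₁ x₁<y₁)))

  conflict→order : ConflictOn (x₁ , y₁) (suc n , y₂) x₁ y₁ y₂ (suc n) → Order
  conflict→order (crossing (inj₁ (_ , b , _))) = inj₁ b
  conflict→order (crossing (inj₂ (_ , _ , c))) = ⊥-elim (<⇒≱ c y₁≤1+n)
  conflict→order (unnested _ 1+n<y₂ _ _)        = ⊥-elim (<⇒≱ 1+n<y₂ (m≤n⇒m≤1+n y₂≤n))
  conflict→order (backwardNestsˡ y₁<x₁ _ _)     = ⊥-elim (<-asym x₁<y₁ y₁<x₁)
  conflict→order (backwardNestsʳ _ _ (y₂≤x₁ , _)) = inj₂ y₂≤x₁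
  conflict→order (linkedˡ y₁≡1+n)              = inj₁ (subst (y₂ <_) (sym y₁≡1+n) (s≤s y₂≤n))
  conflict→order (linkedʳ y₂≡x₁)               = inj₂ (≤-reflexive y₂≡x₁)

  order→conflict : Order → ConflictOn (x₁ , y₁) (suc n , y₂) x₁ y₁ y₂ (suc n)
  order→conflict (inj₂ y₂≤x₁) = backwardNestsʳ (s≤s y₂≤n) x₁<y₁ (y₂≤x₁ , y₁≤1+n)
  order→conflict (inj₁ y₂<y₁) with y₂ ≤? x₁
  ... | yes y₂≤x₁ = backwardNestsʳ (s≤s y₂≤n) x₁<y₁ (y₂≤x₁ , y₁≤1+n)
  ... | no y₂≰x₁ with m≤n⇒m<n∨m≡n y₁≤1+n
  ...   | inj₁ y₁<1+n = crossing (inj₁ (≰⇒> y₂≰x₁ , y₂<y₁ , y₁<1+n))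
  ...   | inj₂ y₁≡1+n = linkedˡ y₁≡1+n

  meet⇔conflict : ChordsMeet ⇔ Conflict (x₁ , y₁) (suc n , y₂)
  meet⇔conflict =
    conflict-endpoints (lo-forward x₁<y₁) (hi-forward x₁<y₁) (lo-backward (s≤s y₂≤n)) (hi-backward (s≤s y₂≤n))
      ⇔-∘ mk⇔ (order→conflict ∘ meet→order) (order→meet ∘ conflict→order)

module BackwardBackward {n x₁ y₁ x₂ y₂ : ℕ}
  (1≤y₁ : 1 ≤ y₁) (y₁<x₁ : y₁ < x₁) (x₁≤n : x₁ ≤ n)
  (1≤y₂ : 1 ≤ y₂) (y₂<x₂ : y₂ < x₂) (x₂≤n : x₂ ≤ n) where

  ChordsMeet : Set
  ChordsMeet = Meet Interleaved (chordPair (backward 1≤y₁ y₁<x₁ x₁≤n)) (chordPair (backward 1≤y₂ y₂<x₂ x₂≤n))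

  Order : Set
  Order = (y₁ < y₂ × y₂ ≤ x₁ × x₁ < x₂) ⊎ (y₂ < y₁ × y₁ ≤ x₂ × x₂ < x₁)

  meet→order : ChordsMeet → Order
  meet→order (₁₁ (inj₁ (a , b , c))) = inj₁ (a , ≤-pred b , ≤-pred c)
  meet→order (₁₁ (inj₂ (a , b , c))) = inj₂ (a , ≤-pred b , ≤-pred c)
  meet→order (₁₂ (inj₁ (_ , b , _))) = ⊥-elim (bar≮unbar b (s≤s x₁≤n))
  meet→order (₁₂ (inj₂ (a , _ , _))) = ⊥-elim (bar≮unbar a (≤-trans (<⇒≤ y₁<x₁) (m≤n⇒m≤1+n x₁≤n)))
  meet→order (₂₁ (inj₁ (a , _ , _))) = ⊥-elim (bar≮unbar a (≤-trans (<⇒≤ y₂<x₂) (m≤n⇒m≤1+n x₂≤n)))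
  meet→order (₂₁ (inj₂ (_ , b , _))) = ⊥-elim (bar≮unbar b (s≤s x₂≤n))
  meet→order (₂₂ (inj₁ (a , b , c))) =
    inj₁ (bar-cancel-< a , ≤-pred (bar-cancel-< b) , ≤-pred (bar-cancel-< c))
  meet→order (₂₂ (inj₂ (a , b , c))) =
    inj₂ (bar-cancel-< a , ≤-pred (bar-cancel-< b) , ≤-pred (bar-cancel-< c))

  order→meet : Order → ChordsMeet
  order→meet (inj₁ (a , b , c)) = ₁₁ (inj₁ (a , s≤s b , s≤s c))
  order→meet (inj₂ (a , b , c)) = ₁₁ (inj₂ (a , s≤s b , s≤s c))

  conflict→order : ConflictOn (x₁ , y₁) (x₂ , y₂) y₁ x₁ y₂ x₂ → Order
  conflict→order (crossing (inj₁ (a , b , c)))  = inj₁ (a , <⇒≤ b , c)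
  conflict→order (crossing (inj₂ (a , b , c)))  = inj₂ (a , <⇒≤ b , c)
  conflict→order (unnested x₁<y₁ _ _ _)         = ⊥-elim (<-asym y₁<x₁ x₁<y₁)
  conflict→order (backwardNestsˡ _ x₂<y₂ _)     = ⊥-elim (<-asym y₂<x₂ x₂<y₂)
  conflict→order (backwardNestsʳ _ x₁<y₁ _)     = ⊥-elim (<-asym y₁<x₁ x₁<y₁)
  conflict→order (linkedˡ y₁≡x₂) =
    inj₂ (subst (y₂ <_) (sym y₁≡x₂) y₂<x₂ , ≤-reflexive y₁≡x₂ , subst (_< x₁) y₁≡x₂ y₁<x₁)
  conflict→order (linkedʳ y₂≡x₁) =
    inj₁ (subst (y₁ <_) (sym y₂≡x₁) y₁<x₁ , ≤-reflexive y₂≡x₁ , subst (_< x₂) y₂≡x₁ y₂<x₂)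

  order→conflict : Order → ConflictOn (x₁ , y₁) (x₂ , y₂) y₁ x₁ y₂ x₂
  order→conflict (inj₁ (y₁<y₂ , y₂≤x₁ , x₁<x₂)) with m≤n⇒m<n∨m≡n y₂≤x₁
  ... | inj₁ y₂<x₁ = crossing (inj₁ (y₁<y₂ , y₂<x₁ , x₁<x₂))
  ... | inj₂ y₂≡x₁ = linkedʳ y₂≡x₁
  order→conflict (inj₂ (y₂<y₁ , y₁≤x₂ , x₂<x₁)) with m≤n⇒m<n∨m≡n y₁≤x₂
  ... | inj₁ y₁<x₂ = crossing (inj₂ (y₂<y₁ , y₁<x₂ , x₂<x₁))
  ... | inj₂ y₁≡x₂ = linkedˡ y₁≡x₂

  meet⇔conflict : ChordsMeet ⇔ Conflict (x₁ , y₁) (x₂ , y₂)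
  meet⇔conflict =
    conflict-endpoints (lo-backward y₁<x₁) (hi-backward y₁<x₁) (lo-backward y₂<x₂) (hi-backward y₂<x₂)
      ⇔-∘ mk⇔ (order→conflict ∘ meet→order) (order→meet ∘ conflict→order)

module BackwardWrapping {n x₁ y₁ y₂ : ℕ}
  (1≤y₁ : 1 ≤ y₁) (y₁<x₁ : y₁ < x₁) (x₁≤n : x₁ ≤ n)
  (1≤y₂ : 1 ≤ y₂) (y₂≤n : y₂ ≤ n) where

  ChordsMeet : Set
  ChordsMeet = Meet Interleaved (chordPair (backward 1≤y₁ y₁<x₁ x₁≤n)) (chordPair (wrapping 1≤y₂ y₂≤n))

  Order : Set
  Order = y₁ < y₂ × y₂ ≤ x₁

  meet→order : ChordsMeet → Order
  meet→order (₁₁ (inj₁ (a , b , _))) = a , ≤-pred b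
  meet→order (₁₁ (inj₂ (_ , _ , c))) = ⊥-elim (bar≮unbar c (s≤s x₁≤n))
  meet→order (₁₂ (inj₁ (a , _ , _))) = ⊥-elim (<⇒≱ a 1≤y₁)
  meet→order (₁₂ (inj₂ (_ , _ , c))) = ⊥-elim (bar≮unbar c (s≤s x₁≤n))
  meet→order (₂₁ (inj₁ (a , _ , _))) = ⊥-elim (bar≮unbar a (m≤n⇒m≤1+n y₂≤n))
  meet→order (₂₁ (inj₂ (_ , b , _))) = ⊥-elim (<⇒≱ (bar-cancel-< b) 1≤y₁)
  meet→order (₂₂ (inj₁ (a , _ , _))) = ⊥-elim (bar≮unbar {n} {y₁} a (s≤s z≤n))
  meet→order (₂₂ (inj₂ (_ , b , c))) = bar-cancel-< b , ≤-pred (bar-cancel-< c)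

  order→meet : Order → ChordsMeet
  order→meet (y₁<y₂ , y₂≤x₁) = ₁₁ (inj₁ (y₁<y₂ , s≤s y₂≤x₁ , unbar<bar (s≤s x₁≤n) (s≤s z≤n)))

  conflict→order : ConflictOn (x₁ , y₁) (suc n , y₂) y₁ x₁ y₂ (suc n) → Order
  conflict→order (crossing (inj₁ (a , b , _))) = a , <⇒≤ b
  conflict→order (crossing (inj₂ (_ , _ , c))) = ⊥-elim (<⇒≱ c (m≤n⇒m≤1+n x₁≤n))
  conflict→order (unnested x₁<y₁ _ _ _)        = ⊥-elim (<-asym y₁<x₁ x₁<y₁)
  conflict→order (backwardNestsˡ _ 1+n<y₂ _)   = ⊥-elim (<⇒≱ 1+n<y₂ (m≤n⇒m≤1+n y₂≤n))
  conflict→order (backwardNestsʳ _ x₁<y₁ _)    = ⊥-elim (<-asym y₁<x₁ x₁<y₁)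
  conflict→order (linkedˡ y₁≡1+n) = ⊥-elim (<⇒≱ (subst (_< x₁) y₁≡1+n y₁<x₁) (m≤n⇒m≤1+n x₁≤n))
  conflict→order (linkedʳ y₂≡x₁)  = subst (y₁ <_) (sym y₂≡x₁) y₁<x₁ , ≤-reflexive y₂≡x₁

  order→conflict : Order → ConflictOn (x₁ , y₁) (suc n , y₂) y₁ x₁ y₂ (suc n)
  order→conflict (y₁<y₂ , y₂≤x₁) with m≤n⇒m<n∨m≡n y₂≤x₁
  ... | inj₁ y₂<x₁ = crossing (inj₁ (y₁<y₂ , y₂<x₁ , s≤s x₁≤n))
  ... | inj₂ y₂≡x₁ = linkedʳ y₂≡x₁

  meet⇔conflict : ChordsMeet ⇔ Conflict (x₁ , y₁) (suc n , y₂)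
  meet⇔conflict =
    conflict-endpoints (lo-backward y₁<x₁) (hi-backward y₁<x₁) (lo-backward (s≤s y₂≤n)) (hi-backward (s≤s y₂≤n))
      ⇔-∘ mk⇔ (order→conflict ∘ meet→order) (order→meet ∘ conflict→order)

module WrappingWrapping {n y₁ y₂ : ℕ} (1≤y₁ : 1 ≤ y₁) (y₁≤n : y₁ ≤ n) (1≤y₂ : 1 ≤ y₂) (y₂≤n : y₂ ≤ n) where

  ChordsMeet : Set
  ChordsMeet = Meet Interleaved (chordPair (wrapping 1≤y₁ y₁≤n)) (chordPair (wrapping 1≤y₂ y₂≤n))

  ¬meet : ¬ ChordsMeet
  ¬meet (₁₁ (inj₁ (_ , _ , c))) = <-irrefl refl c
  ¬meet (₁₁ (inj₂ (_ , _ , c))) = <-irrefl refl c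
  ¬meet (₁₂ (inj₁ (a , _ , _))) = <⇒≱ a 1≤y₁
  ¬meet (₁₂ (inj₂ (_ , _ , c))) = <⇒≱ (bar-cancel-< c) 1≤y₂
  ¬meet (₂₁ (inj₁ (_ , _ , c))) = <⇒≱ (bar-cancel-< c) 1≤y₁
  ¬meet (₂₁ (inj₂ (a , _ , _))) = <⇒≱ a 1≤y₂
  ¬meet (₂₂ (inj₁ (a , _ , _))) = <-irrefl refl a
  ¬meet (₂₂ (inj₂ (a , _ , _))) = <-irrefl refl a

  ¬conflict : ¬ ConflictOn (suc n , y₁) (suc n , y₂) y₁ (suc n) y₂ (suc n)
  ¬conflict (crossing (inj₁ (_ , _ , c)))  = <-irrefl refl c
  ¬conflict (crossing (inj₂ (_ , _ , c)))  = <-irrefl refl c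
  ¬conflict (unnested 1+n<y₁ _ _ _)        = <⇒≱ 1+n<y₁ (m≤n⇒m≤1+n y₁≤n)
  ¬conflict (backwardNestsˡ _ 1+n<y₂ _)    = <⇒≱ 1+n<y₂ (m≤n⇒m≤1+n y₂≤n)
  ¬conflict (backwardNestsʳ _ 1+n<y₁ _)    = <⇒≱ 1+n<y₁ (m≤n⇒m≤1+n y₁≤n)
  ¬conflict (linkedˡ y₁≡1+n)               = <⇒≱ (n<1+n n) (subst (_≤ n) y₁≡1+n y₁≤n)
  ¬conflict (linkedʳ y₂≡1+n)               = <⇒≱ (n<1+n n) (subst (_≤ n) y₂≡1+n y₂≤n)

  meet⇔conflict : ChordsMeet ⇔ Conflict (suc n , y₁) (suc n , y₂)
  meet⇔conflict =
    conflict-endpoints (lo-backward (s≤s y₁≤n)) (hi-backward (s≤s y₁≤n)) (lo-backward (s≤s y₂≤n)) (hi-backward (s≤s y₂≤n))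
      ⇔-∘ mk⇔ (⊥-elim ∘ ¬meet) (⊥-elim ∘ ¬conflict)

meet⇔conflict-swap : ∀ {A B a b} → Meet Interleaved A B ⇔ Conflict a b → Meet Interleaved B A ⇔ Conflict b a
meet⇔conflict-swap meet⇔conflict =
  mk⇔ (conflictOn-sym ∘ Equivalence.to meet⇔conflict ∘ meet-sym interleaved-sym)
      (meet-sym interleaved-sym ∘ Equivalence.from meet⇔conflict ∘ conflictOn-sym)

meet⇔conflict : ∀ {n a b} (k : Kind n a) (k′ : Kind n b) →
                Meet Interleaved (chordPair k) (chordPair k′) ⇔ Conflict a b
meet⇔conflict (forward p q r) (forward p′ q′ r′)  = ForwardForward.meet⇔conflict p q r p′ q′ r′
meet⇔conflict (forward p q r) (backward p′ q′ r′) = ForwardBackward.meet⇔conflict p q r p′ q′ r′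
meet⇔conflict (forward p q r) (wrapping p′ q′)    = ForwardWrapping.meet⇔conflict p q r p′ q′
meet⇔conflict (backward p q r) (forward p′ q′ r′) =
  meet⇔conflict-swap (ForwardBackward.meet⇔conflict p′ q′ r′ p q r)
meet⇔conflict (backward p q r) (backward p′ q′ r′) = BackwardBackward.meet⇔conflict p q r p′ q′ r′
meet⇔conflict (backward p q r) (wrapping p′ q′)    = BackwardWrapping.meet⇔conflict p q r p′ q′
meet⇔conflict (wrapping p q) (forward p′ q′ r′)  = meet⇔conflict-swap (ForwardWrapping.meet⇔conflict p′ q′ r′ p q)
meet⇔conflict (wrapping p q) (backward p′ q′ r′) = meet⇔conflict-swap (BackwardWrapping.meet⇔conflict p′ q′ r′ p q)
meet⇔conflict (wrapping p q) (wrapping p′ q′)    = WrappingWrapping.meet⇔conflict p q p′ q′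

bcross⇔conflict : ∀ {n d d′} → IsBDiag n d → IsBDiag n d′ →
                  IsArrow n (arrowRep n d) → IsArrow n (arrowRep n d′) →
                  BCross n d d′ ⇔ Conflict (arrowRep n d) (arrowRep n d′)
bcross⇔conflict {n} {d} {d′} valid valid′ arrow arrow′ with chords-spans valid arrow | chords-spans valid′ arrow′
... | k , spans | k′ , spans′ = begin
  BCross n d d′                                 ∼⟨ bcross⇔meet spans spans′ ⟩
  Meet ChordCross (chordPair k) (chordPair k′)  ∼⟨ meet-sorted (chordPair-sorted k) (chordPair-sorted k′) ⟩
  Meet Interleaved (chordPair k) (chordPair k′) ∼⟨ meet⇔conflict k k′ ⟩
  Conflict (arrowRep n d) (arrowRep n d′)       ∎
  where open EquationalReasoning

-- Faces as conflict-free sets of arrows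

ConflictFree : (Arrow → Set) → Set
ConflictFree S = ∀ a b → S a → S b → ¬ Conflict a b

arrow-tail≢head : ∀ {n a} → IsArrow n a → tail a ≢ head a
arrow-tail≢head (_ , _ , _ , _ , x≢y) = x≢y

conditions⇔conflictFree : ∀ {S} → (∀ a → S a → tail a ≢ head a) →
                          (Cond1 S × Cond2 S × Cond3 S × Cond4 S) ⇔ ConflictFree S
conditions⇔conflictFree {S} t≢h = mk⇔ to from
  where
  to : Cond1 S × Cond2 S × Cond3 S × Cond4 S → ConflictFree S
  to (cond1 , cond2 , cond3 , cond4) a b Sa Sb conflict with ≡-dec _≟_ _≟_ a b
  ... | yes refl = conflict-irreflexive (t≢h a Sa) conflict
  ... | no a≢b with conflict
  ...   | crossing cr                 = cond1 a b Sa Sb a≢b cr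
  ...   | backwardNestsˡ ba fb nab    = cond3 a b Sa Sb ba fb nab
  ...   | backwardNestsʳ bb fa nba    = cond3 b a Sb Sa bb fa nba
  ...   | linkedˡ e                   = cond4 a b Sa Sb a≢b e
  ...   | linkedʳ e                   = cond4 b a Sb Sa (a≢b ∘ sym) e
  ...   | unnested fa fb ¬nab ¬nba with cond2 a b Sa Sb a≢b fa fb
  ...     | inj₁ nab = ¬nab nab
  ...     | inj₂ nba = ¬nba nba
  from : ConflictFree S → Cond1 S × Cond2 S × Cond3 S × Cond4 S
  from free = cond1 , cond2 , cond3 , cond4
    where
    cond1 : Cond1 S
    cond1 a b Sa Sb _ cr = free a b Sa Sb (crossing cr)
    cond2 : Cond2 S
    cond2 a b Sa Sb _ fa fb with (lo a ≤? lo b) ×-dec (hi b ≤? hi a) | (lo b ≤? lo a) ×-dec (hi a ≤? hi b)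
    ... | yes nab | _        = inj₁ nab
    ... | no _    | yes nba  = inj₂ nba
    ... | no ¬nab | no ¬nba  = ⊥-elim (free a b Sa Sb (unnested fa fb ¬nab ¬nba))
    cond3 : Cond3 S
    cond3 a b Sa Sb ba fb nab = free a b Sa Sb (backwardNestsˡ ba fb nab)
    cond4 : Cond4 S
    cond4 a b Sa Sb _ e = free a b Sa Sb (linkedˡ e)

face⇔conflictFree : ∀ {n S} → (∀ a → S a → IsArrow n a) → IsFace n (diagsOf n S) ⇔ ConflictFree S
face⇔conflictFree {n} {S} arrow = mk⇔ to from
  where
  to : IsFace n (diagsOf n S) → ConflictFree S
  to (_ , noncrossing) a b Sa Sb conflict with ≡-dec _≟_ _≟_ a b
  ... | yes refl = conflict-irreflexive (arrow-tail≢head (arrow a Sa)) conflict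
  ... | no a≢b with diagonalOf (kind (arrow a Sa)) | diagonalOf (kind (arrow b Sb))
  ...   | d , valid , refl | d′ , valid′ , refl =
    noncrossing d d′ (valid , Sa) (valid′ , Sb) (a≢b ∘ cong (arrowRep n))
      (Equivalence.from (bcross⇔conflict valid valid′ (arrow _ Sa) (arrow _ Sb)) conflict)
  from : ConflictFree S → IsFace n (diagsOf n S)
  from free = (λ _ → proj₁) , λ { d d′ (valid , Sd) (valid′ , Sd′) _ bcross →
    free _ _ Sd Sd′ (Equivalence.to (bcross⇔conflict valid valid′ (arrow _ Sd) (arrow _ Sd′)) bcross) }

proposition8p2 : (n : ℕ) → 1 ≤ n → (S : Arrow → Set) → (∀ a → S a → IsArrow n a) →
    (IsFace n (diagsOf n S) ⇔ (Cond1 S × Cond2 S × Cond3 S × Cond4 S))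
proposition8p2 n _ S arrow =
  ⇔-sym (conditions⇔conflictFree (λ a → arrow-tail≢head ∘ arrow a)) ⇔-∘ face⇔conflictFree arrow
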